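{- Let $G$ be a finite simple graph, let $g,f:V(G)\rightarrow \mathbb{Z}^{+}$ be two functions with $g(x)\leq f(x)$ for each vertex $x\in V(G)$, and let $H$ be a subgraph of $G$. Then $G$ has all fractional $(g,f)$-factors including $H$ if and only if $$ g(S)+d_{G-S}(T)-f(T)\geq d_H(S)-e_H(S,T) $$ for all disjoint subsets $S$ and $T$ of $V(G)$.
   Context: Graphs are finite, undirected, without loops or multiple edges. $\mathbb{Z}^{+}$ denotes the positive integers and $N$ the nonnegative integers. For $x\in V(G)$, $d_G(x)$ is the degree of $x$ in $G$ and $E(x)$ is the set of edges of $G$ incident with $x$. For a subgraph $H$ of $G$ and $x\in V(G)$, $d_H(x)$ is the degree of $x$ in $H$ (taken as $0$ if $x\notin V(H)$). For any function $\varphi:V(G)\rightarrow N$ and $S\subseteq V(G)$, $\varphi(S)=\sum_{x\in S}\varphi(x)$ with $\varphi(\emptyset)=0$; in particular $d_G(S)=\sum_{x\in S}d_G(x)$, $d_H(S)=\sum_{x\in S}d_H(x)$, and $d_{G-S}(T)=\sum_{x\in T}d_{G-S}(x)$, where $G-S$ is the graph obtained from $G$ by deleting the vertices of $S$ and their incident edges. For disjoint $S,T\subseteq V(G)$, $e_H(S,T)$ is the number of edges of $H$ joining a vertex of $S$ to a vertex of $T$. For $r:V(G)\rightarrow N$, a fractional $r$-factor of $G$ is given by a function $h:E(G)\rightarrow[0,1]$ (its indicator function) with $\sum_{e\in E(x)}h(e)=r(x)$ for every $x\in V(G)$; the factor $F_h$ is the spanning subgraph with edge set $\{e\in E(G):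 h(e)>0\}$. $G$ has all fractional $(g,f)$-factors including $H$ if for every $r:V(G)\rightarrow N$ with $g(x)\leq r(x)\leq f(x)$ for each $x\in V(G)$, $G$ has a fractional $r$-factor whose indicator function $h$ satisfies $h(e)=1$ for every $e\in E(H)$.
   Formalization: The indicator function h of a fractional r-factor takes values in the rationals of $[0,1]$ rather than in the real interval. -}

module Defs where

open import Data.Nat as ℕ using (ℕ; zero; suc; _≤_)
open import Data.Integer as ℤ using (ℤ; +_)
open import Data.Rational as ℚ using (ℚ; 0ℚ; 1ℚ)
open import Data.Fin using (Fin; zero; suc)
open import Data.Bool using (Bool; true; false; if_then_else_; not; _∧_)
open import Data.Product using (Σ; Σ-syntax; _×_; _,_)
open import Relation.Binary.PropositionalEquality using (_≡_)

sumℕ : ∀ {n} → (Fin n → ℕ) → ℕ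
sumℕ {zero}  f = 0
sumℕ {suc n} f = f zero ℕ.+ sumℕ (λ i → f (suc i))

sumℚ : ∀ {n} → (Fin n → ℚ) → ℚ
sumℚ {zero}  f = 0ℚ
sumℚ {suc n} f = f zero ℚ.+ sumℚ (λ i → f (suc i))

[_] : Bool → ℕ
[ true ]  = 1
[ false ] = 0

record Graph (n : ℕ) : Set where
  field
    adj    : Fin n → Fin n → Bool
    sym    : ∀ x y → adj x y ≡ adj y x
    irrefl : ∀ x → adj x x ≡ false
open Graph public

-- H is a subgraph of G (edges of H are edges of G; vertices of H not
-- incident to an edge of H only matter through degree 0).
_⊆G_ : ∀ {n} → Graph n → Graph n → Set
H ⊆G G = ∀ x y → adj H x y ≡ true → adj G x y ≡ true

VSet : ℕ → Set
VSet n = Fin n → Bool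

Disjoint : ∀ {n} → VSet n → VSet n → Set
Disjoint S T = ∀ x → S x ≡ true → T x ≡ false

deg : ∀ {n} → Graph n → Fin n → ℕ
deg G x = sumℕ (λ y → [ adj G x y ])

setSum : ∀ {n} → (Fin n → ℕ) → VSet n → ℕ
setSum φ S = sumℕ (λ x → if S x then φ x else 0)

degMinus : ∀ {n} → Graph n → VSet n → Fin n → ℕ
degMinus G S x = if S x then 0 else sumℕ (λ y → [ not (S y) ∧ adj G x y ])

eBetween : ∀ {n} → Graph n → VSet n → VSet n → ℕ
eBetween H S T = sumℕ (λ x → sumℕ (λ y → [ S x ∧ (T y ∧ adj H x y) ]))

ℕtoℚ : ℕ → ℚ
ℕtoℚ k = + k ℚ./ 1

-- h : E(G) → [0,1], represented as a symmetric function on pairs whose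
-- values on non-edges are irrelevant.  Fractional r-factor of G whose
-- indicator function is 1 on every edge of H.
FractionalFactorIncluding : ∀ {n} → Graph n → Graph n → (Fin n → ℕ) → Set
FractionalFactorIncluding {n} G H r =
  Σ[ h ∈ (Fin n → Fin n → ℚ) ]
    ( (∀ x y → h x y ≡ h y x)
    × (∀ x y → adj G x y ≡ true → (0ℚ ℚ.≤ h x y) × (h x y ℚ.≤ 1ℚ))
    × (∀ x → sumℚ (λ y → if adj G x y then h x y else 0ℚ) ≡ ℕtoℚ (r x))
    × (∀ x y → adj H x y ≡ true → h x y ≡ 1ℚ) )

AllFractionalFactorsIncluding : ∀ {n} → Graph n → Graph n → (Fin n → ℕ) → (Fin n → ℕ) → Set
AllFractionalFactorsIncluding G H g f =
  ∀ r → (∀ x → g x ≤ r x) → (∀ x → r x ≤ f x) → FractionalFactorIncluding G H r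

Condition : ∀ {n} → Graph n → Graph n → (Fin n → ℕ) → (Fin n → ℕ) → VSet n → VSet n → Set
Condition G H g f S T =
  (+ setSum (deg H) S) ℤ.- (+ eBetween H S T)
    ℤ.≤ ((+ setSum g S) ℤ.+ (+ setSum (degMinus G S) T)) ℤ.- (+ setSum f T)

module Submission where

-- Necessity: take r = f on T and r = g elsewhere. Summing the degree equations of a fractional
-- r-factor h over S and over T, the inequality becomes a sum of the nonnegative terms
-- h(xy) − [xy ∈ H] (x ∈ S, y ∉ T) and [xy ∈ G] − h(xy) (x ∈ T, y ∉ S).
--
-- Sufficiency: fix r with g ≤ r ≤ f. It is enough to find a 0/1 matrix φ supported on the edges of
-- G − H whose row sums and column sums all equal r − d_H: then h = 1 on H and
-- h(xy) = (φ(x,y) + φ(y,x))/2 on G − H is a fractional r-factor containing H. By a Gale–Ryser type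
-- criterion such a φ exists as soon as a(X) ≤ a(Y) + #{cells of G − H in X × Yᶜ} for all X, Y,
-- where a = r − d_H, and this cut condition is the assumed inequality for S = Y ∖ X and T = X ∖ Y.
-- The criterion is proved by induction on the support: either a cell can be deleted, or it can be
-- deleted and used, and if neither works the two violated cuts uncross, by submodularity, to a
-- contradiction.

open import Algebra.Bundles using (CommutativeMonoid; RawMonoid)
import Algebra.Definitions.RawMonoid as RawMonoidSum
import Algebra.Properties.CommutativeMonoid.Sum as CommutativeMonoidSum
open import Data.Bool using (Bool; true; false; if_then_else_; not; _∧_; _∨_)
import Data.Bool as Bool
open import Data.Bool.Properties using (¬-not; ∧-comm; ∧-conicalˡ)
open import Data.Empty using (⊥; ⊥-elim)
open import Data.Fin using (Fin; zero; suc)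
open import Data.Fin.Properties using (_≟_; any?)
import Data.Integer.Properties as ℤP
open import Data.Nat as ℕ using (ℕ; zero; suc; s≤s)
import Data.Nat.Properties as ℕP
open import Data.Product using (∃₂; _×_; _,_; proj₁; proj₂)
import Data.Rational.Properties as ℚP
open import Data.Sum using (_⊎_; inj₁; inj₂)
open import Function using (case_of_)
open import Relation.Binary.PropositionalEquality
  using (_≡_; refl; sym; trans; cong; cong₂; subst; subst₂; module ≡-Reasoning)
open import Relation.Nullary using (does; yes; no; ¬?)
open import Relation.Nullary.Decidable using (decidable-stable; True; toWitness)
open import Defs hiding (sym)

∧-not-conicalʳ : ∀ x y → x ∧ not y ≡ true → y ≡ false
∧-not-conicalʳ true false _ = refl

BoolMatrix : ℕ → ℕ → Set
BoolMatrix m n = Fin m → Fin n → Bool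

_∖⟨_,_⟩ : ∀ {m n} → BoolMatrix m n → Fin m → Fin n → BoolMatrix m n
(M ∖⟨ u , v ⟩) i j = M i j ∧ not (does (u ≟ i) ∧ does (v ≟ j))

cell⇒support : ∀ {m n} (M : BoolMatrix m n) {u v} i j → M u v ≡ true →
               does (u ≟ i) ∧ does (v ≟ j) ≡ true → M i j ≡ true
cell⇒support M {u} {v} i j Muv cell with u ≟ i | v ≟ j
cell⇒support M i j Muv cell | yes refl | yes refl = Muv
cell⇒support M i j Muv ()   | no _     | _
cell⇒support M i j Muv ()   | yes _    | no _

module FinSum {c ℓ} (CM : CommutativeMonoid c ℓ) where

  open CommutativeMonoid CM
    renaming (_∙_ to _+_; ε to 0#; refl to ≈-refl; sym to ≈-sym; trans to ≈-trans)
  open CommutativeMonoidSum CM public using (sum; ∑-distrib-+; ∑-comm; sum-cong-≗)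
  open CommutativeMonoidSum CM using (sum-cong-≋; sum-replicate-zero)
  open import Relation.Binary.Reasoning.Setoid setoid

  sum₂ : ∀ {m n} → (Fin m → Fin n → Carrier) → Carrier
  sum₂ w = sum (λ i → sum (w i))

  supportSum : ∀ {m n} → BoolMatrix m n → (Fin m → Fin n → Carrier) → Carrier
  supportSum M w = sum₂ (λ i j → if M i j then w i j else 0#)

  sum-zero : ∀ {n} → sum {n} (λ _ → 0#) ≈ 0#
  sum-zero {n} = sum-replicate-zero n

  sum-if : ∀ {n} b (x : Fin n → Carrier) → sum (λ j → if b then x j else 0#) ≈ (if b then sum x else 0#)
  sum-if     true  x = ≈-refl
  sum-if {n} false x = sum-zero {n}

  sum-single : ∀ {n} (v : Fin n) (x : Fin n → Carrier) → sum (λ j → if does (v ≟ j) then x j else 0#) ≈ x v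
  sum-single {suc n} zero    x = ≈-trans (∙-congˡ (sum-zero {n})) (identityʳ (x zero))
  sum-single {suc n} (suc v) x = ≈-trans (identityˡ _) (sum-single v (λ j → x (suc j)))

  sum₂-distrib-+ : ∀ {m n} (f g : Fin m → Fin n → Carrier) → sum₂ (λ i j → f i j + g i j) ≈ sum₂ f + sum₂ g
  sum₂-distrib-+ f g =
    ≈-trans (sum-cong-≋ (λ i → ∑-distrib-+ (f i) (g i))) (∑-distrib-+ (λ i → sum (f i)) (λ i → sum (g i)))

  module _ {r} {_≤_ : Carrier → Carrier → Set r} (≤-refl : ∀ {x} → x ≤ x)
           (+-mono-≤ : ∀ {x y z w} → x ≤ y → z ≤ w → (x + z) ≤ (y + w)) where

    sum-mono : ∀ {n} {f g : Fin n → Carrier} → (∀ i → f i ≤ g i) → sum f ≤ sum g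
    sum-mono {zero}  f≤g = ≤-refl
    sum-mono {suc n} f≤g = +-mono-≤ (f≤g zero) (sum-mono (λ i → f≤g (suc i)))

  sum-homo : ∀ {a ℓ′} (R : RawMonoid a ℓ′) (h : RawMonoid.Carrier R → Carrier) →
             h (RawMonoid.ε R) ≈ 0# → (∀ x y → h (RawMonoid._∙_ R x y) ≈ h x + h y) →
             ∀ {n} (f : Fin n → RawMonoid.Carrier R) → h (RawMonoidSum.sum R f) ≈ sum (λ i → h (f i))
  sum-homo R h h-ε h-∙ {zero}  f = h-ε
  sum-homo R h h-ε h-∙ {suc n} f = ≈-trans (h-∙ (f zero) _) (∙-congˡ (sum-homo R h h-ε h-∙ (λ i → f (suc i))))

  sum-cell : ∀ {m n} (u : Fin m) (v : Fin n) (w : Fin m → Fin n → Carrier) →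
             sum₂ (λ i j → if does (u ≟ i) ∧ does (v ≟ j) then w i j else 0#) ≈ w u v
  sum-cell u v w = begin
    sum₂ (λ i j → if does (u ≟ i) ∧ does (v ≟ j) then w i j else 0#)
      ≡⟨ sum-cong-≗ (λ i → sum-cong-≗ λ j → if-∧ (does (u ≟ i)) (does (v ≟ j))) ⟩
    sum (λ i → sum (λ j → if does (u ≟ i) then (if does (v ≟ j) then w i j else 0#) else 0#))
      ≈⟨ sum-cong-≋ (λ i → sum-if (does (u ≟ i)) (λ j → if does (v ≟ j) then w i j else 0#)) ⟩
    sum (λ i → if does (u ≟ i) then sum (λ j → if does (v ≟ j) then w i j else 0#) else 0#)
      ≈⟨ sum-single u _ ⟩
    sum (λ j → if does (v ≟ j) then w u j else 0#)
      ≈⟨ sum-single v (w u) ⟩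
    w u v ∎
    where
    if-∧ : ∀ a b {x} → (if a ∧ b then x else 0#) ≡ (if a then (if b then x else 0#) else 0#)
    if-∧ true  b = refl
    if-∧ false b = refl

  supportSum-remove : ∀ {m n} (M : BoolMatrix m n) {u v} (w : Fin m → Fin n → Carrier) →
                      M u v ≡ true → supportSum M w ≈ w u v + supportSum (M ∖⟨ u , v ⟩) w
  supportSum-remove M {u} {v} w Muv = begin
    supportSum M w
      ≈⟨ sum-cong-≋ (λ i → sum-cong-≋ λ j → split (M i j) _ (w i j) (cell⇒support M i j Muv)) ⟩
    sum₂ (λ i j → cell i j + rest i j)
      ≈⟨ sum₂-distrib-+ cell rest ⟩
    sum₂ cell + supportSum (M ∖⟨ u , v ⟩) w
      ≈⟨ ∙-congʳ (sum-cell u v w) ⟩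
    w u v + supportSum (M ∖⟨ u , v ⟩) w ∎
    where
    cell rest : Fin _ → Fin _ → Carrier
    cell i j = if does (u ≟ i) ∧ does (v ≟ j) then w i j else 0#
    rest i j = if (M ∖⟨ u , v ⟩) i j then w i j else 0#
    split : ∀ (b c : Bool) x → (c ≡ true → b ≡ true) →
            (if b then x else 0#) ≈ (if c then x else 0#) + (if b ∧ not c then x else 0#)
    split true  true  x _ = ≈-sym (identityʳ x)
    split true  false x _ = ≈-sym (identityˡ x)
    split false true  x c⇒b = case c⇒b refl of λ ()
    split false false x _ = ≈-sym (identityˡ 0#)

module ℕΣ = FinSum ℕP.+-0-commutativeMonoid
module ℤΣ = FinSum ℤP.+-0-commutativeMonoid
module ℚΣ = FinSum ℚP.+-0-commutativeMonoid

module Margins where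

  open import Data.Fin.Subset.Properties using (anySubset?)
  open import Data.Integer as ℤ using (ℤ; 0ℤ; 1ℤ; _+_; _-_; -_; _≤_; _<_)
  open import Data.Integer.Tactic.RingSolver using (solve-∀)
  open import Data.Vec using (lookup; tabulate)
  open import Data.Vec.Properties using (lookup∘tabulate)

  [_]ℤ : Bool → ℤ
  [ b ]ℤ = if b then 1ℤ else 0ℤ

  decideℤ : {x y : ℤ} → True (x ℤP.≤? y) → x ≤ y
  decideℤ = toWitness

  ℤsum-sub : ∀ {n} (f g : Fin n → ℤ) → ℤΣ.sum (λ i → f i - g i) ≡ ℤΣ.sum f - ℤΣ.sum g
  ℤsum-sub f g = trans (ℤΣ.∑-distrib-+ f (λ i → - g i)) (cong (λ z → ℤΣ.sum f + z) neg-sum)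
    where neg-sum = sym (ℤΣ.sum-homo ℤ.+-0-rawMonoid -_ refl ℤP.neg-distrib-+ g)

  ℤsum-mono : ∀ {n} {f g : Fin n → ℤ} → (∀ i → f i ≤ g i) → ℤΣ.sum f ≤ ℤΣ.sum g
  ℤsum-mono = ℤΣ.sum-mono (λ {x} → ℤP.≤-refl {x}) (λ {x y z w} → ℤP.+-mono-≤ {x} {y} {z} {w})

  ℤ+-cancelʳ-≤ : ∀ {i j} k → i + k ≤ j + k → i ≤ j
  ℤ+-cancelʳ-≤ {i} {j} k i+k≤j+k = subst₂ _≤_ (cancel i k) (cancel j k) (ℤP.+-monoˡ-≤ (- k) i+k≤j+k)
    where
    cancel : ∀ x y → (x + y) + - y ≡ x
    cancel = solve-∀

  _∪_ _∩_ : ∀ {n} → VSet n → VSet n → VSet n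
  (X ∪ Y) i = X i ∨ Y i
  (X ∩ Y) i = X i ∧ Y i

  weight : ∀ {k} → (Fin k → ℤ) → VSet k → ℤ
  weight a X = ℤΣ.sum (λ i → if X i then a i else 0ℤ)

  weight-single : ∀ {k} (a : Fin k → ℤ) i → weight a (λ j → does (i ≟ j)) ≡ a i
  weight-single a i = ℤΣ.sum-single i a

  weight-complement : ∀ {k} (a : Fin k → ℤ) X → weight a X + weight a (λ i → not (X i)) ≡ ℤΣ.sum a
  weight-complement a X =
    trans (sym (ℤΣ.∑-distrib-+ (λ i → if X i then a i else 0ℤ) (λ i → if not (X i) then a i else 0ℤ)))
          (ℤΣ.sum-cong-≗ λ i → pointwise (X i) (a i))
    where
    pointwise : ∀ x c → (if x then c else 0ℤ) + (if not x then c else 0ℤ) ≡ c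
    pointwise true  c = ℤP.+-identityʳ c
    pointwise false c = ℤP.+-identityˡ c

  weight-modular : ∀ {k} (a : Fin k → ℤ) X Y → weight a (X ∪ Y) + weight a (X ∩ Y) ≡ weight a X + weight a Y
  weight-modular a X Y = begin
    weight a (X ∪ Y) + weight a (X ∩ Y)
      ≡⟨ ℤΣ.∑-distrib-+ (restrict (X ∪ Y)) (restrict (X ∩ Y)) ⟨
    ℤΣ.sum (λ i → restrict (X ∪ Y) i + restrict (X ∩ Y) i)
      ≡⟨ ℤΣ.sum-cong-≗ (λ i → pointwise (X i) (Y i) (a i)) ⟩
    ℤΣ.sum (λ i → restrict X i + restrict Y i)
      ≡⟨ ℤΣ.∑-distrib-+ (restrict X) (restrict Y) ⟩
    weight a X + weight a Y ∎
    where
    open ≡-Reasoning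
    restrict : VSet _ → Fin _ → ℤ
    restrict Z i = if Z i then a i else 0ℤ
    pointwise : ∀ x y c → (if x ∨ y then c else 0ℤ) + (if x ∧ y then c else 0ℤ)
                          ≡ (if x then c else 0ℤ) + (if y then c else 0ℤ)
    pointwise true  _     c = refl
    pointwise false true  c = ℤP.+-comm c 0ℤ
    pointwise false false c = refl

  _↓_ : ∀ {k} → (Fin k → ℤ) → Fin k → Fin k → ℤ
  (a ↓ u) i = a i - [ does (u ≟ i) ]ℤ

  weight-↓ : ∀ {k} (a : Fin k → ℤ) u X → weight (a ↓ u) X ≡ weight a X - [ X u ]ℤ
  weight-↓ a u X = begin
    weight (a ↓ u) X
      ≡⟨ ℤΣ.sum-cong-≗ (λ i → pointwise (X i) (does (u ≟ i)) (a i)) ⟩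
    ℤΣ.sum (λ i → (if X i then a i else 0ℤ) - (if does (u ≟ i) then [ X i ]ℤ else 0ℤ))
      ≡⟨ ℤsum-sub (λ i → if X i then a i else 0ℤ) (λ i → if does (u ≟ i) then [ X i ]ℤ else 0ℤ) ⟩
    weight a X - ℤΣ.sum (λ i → if does (u ≟ i) then [ X i ]ℤ else 0ℤ)
      ≡⟨ cong (λ z → weight a X - z) (ℤΣ.sum-single u (λ i → [ X i ]ℤ)) ⟩
    weight a X - [ X u ]ℤ ∎
    where
    open ≡-Reasoning
    pointwise : ∀ x d c → (if x then c - [ d ]ℤ else 0ℤ) ≡ (if x then c else 0ℤ) - (if d then [ x ]ℤ else 0ℤ)
    pointwise true  d     c = refl
    pointwise false true  c = refl
    pointwise false false c = refl

  module _ {m n : ℕ} where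

    cut : BoolMatrix m n → VSet m → VSet n → ℤ
    cut M X Y = ℤΣ.supportSum M (λ i j → [ X i ∧ not (Y j) ]ℤ)

    CutCondition : BoolMatrix m n → (Fin m → ℤ) → (Fin n → ℤ) → Set
    CutCondition M a b = ∀ X Y → weight a X ≤ weight b Y + cut M X Y

    slack : BoolMatrix m n → (Fin m → ℤ) → (Fin n → ℤ) → VSet m → VSet n → ℤ
    slack M a b X Y = (weight b Y + cut M X Y) - weight a X

    rowSum : BoolMatrix m n → Fin m → ℤ
    rowSum φ i = ℤΣ.sum (λ j → [ φ i j ]ℤ)

    colSum : BoolMatrix m n → Fin n → ℤ
    colSum φ j = ℤΣ.sum (λ i → [ φ i j ]ℤ)

    record Realisation (M : BoolMatrix m n) (a : Fin m → ℤ) (b : Fin n → ℤ) : Set where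
      field
        matrix   : BoolMatrix m n
        ⊆support : ∀ i j → matrix i j ≡ true → M i j ≡ true
        row-sums : ∀ i → rowSum matrix i ≡ a i
        col-sums : ∀ j → colSum matrix j ≡ b j

    count : BoolMatrix m n → ℕ
    count M = ℕΣ.supportSum M (λ _ _ → 1)

  cut-submodular : ∀ {m n} (M : BoolMatrix m n) X₁ X₂ Y₁ Y₂ →
                   cut M (X₁ ∪ X₂) (Y₁ ∪ Y₂) + cut M (X₁ ∩ X₂) (Y₁ ∩ Y₂) ≤ cut M X₁ Y₁ + cut M X₂ Y₂
  cut-submodular {m} {n} M X₁ X₂ Y₁ Y₂ =
    subst₂ _≤_ (ℤΣ.sum₂-distrib-+ w∪ w∩) (ℤΣ.sum₂-distrib-+ w₁ w₂)
      (ℤsum-mono λ i → ℤsum-mono λ j → pointwise (M i j) (X₁ i) (X₂ i) (Y₁ j) (Y₂ j))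
    where
    w∪ w∩ w₁ w₂ : Fin m → Fin n → ℤ
    w∪ i j = if M i j then [ (X₁ i ∨ X₂ i) ∧ not (Y₁ j ∨ Y₂ j) ]ℤ else 0ℤ
    w∩ i j = if M i j then [ (X₁ i ∧ X₂ i) ∧ not (Y₁ j ∧ Y₂ j) ]ℤ else 0ℤ
    w₁ i j = if M i j then [ X₁ i ∧ not (Y₁ j) ]ℤ else 0ℤ
    w₂ i j = if M i j then [ X₂ i ∧ not (Y₂ j) ]ℤ else 0ℤ
    cell : ∀ x₁ x₂ y₁ y₂ → [ (x₁ ∨ x₂) ∧ not (y₁ ∨ y₂) ]ℤ + [ (x₁ ∧ x₂) ∧ not (y₁ ∧ y₂) ]ℤ
                            ≤ [ x₁ ∧ not y₁ ]ℤ + [ x₂ ∧ not y₂ ]ℤ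
    cell false false _     _     = ℤP.≤-refl
    cell true  true  true  _     = ℤP.≤-refl
    cell true  true  false y₂    = ℤP.≤-reflexive (ℤP.+-comm [ not y₂ ]ℤ 1ℤ)
    cell true  false true  _     = ℤP.≤-refl
    cell true  false false true  = decideℤ _
    cell true  false false false = decideℤ _
    cell false true  true  true  = decideℤ _
    cell false true  true  false = decideℤ _
    cell false true  false true  = decideℤ _
    cell false true  false false = decideℤ _
    pointwise : ∀ μ x₁ x₂ y₁ y₂ →
      (if μ then [ (x₁ ∨ x₂) ∧ not (y₁ ∨ y₂) ]ℤ else 0ℤ)
        + (if μ then [ (x₁ ∧ x₂) ∧ not (y₁ ∧ y₂) ]ℤ else 0ℤ)
      ≤ (if μ then [ x₁ ∧ not y₁ ]ℤ else 0ℤ) + (if μ then [ x₂ ∧ not y₂ ]ℤ else 0ℤ)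
    pointwise true  = cell
    pointwise false _ _ _ _ = ℤP.≤-refl

  slack-submodular : ∀ {m n} (M : BoolMatrix m n) a b X₁ X₂ Y₁ Y₂ →
                     slack M a b (X₁ ∪ X₂) (Y₁ ∪ Y₂) + slack M a b (X₁ ∩ X₂) (Y₁ ∩ Y₂)
                     ≤ slack M a b X₁ Y₁ + slack M a b X₂ Y₂
  slack-submodular M a b X₁ X₂ Y₁ Y₂ = begin
    ((b∪ + c∪) - a∪) + ((b∩ + c∩) - a∩)
      ≡⟨ regroup b∪ b∩ c∪ c∩ a∪ a∩ ⟩
    ((b∪ + b∩) + (c∪ + c∩)) - (a∪ + a∩)
      ≡⟨ cong₂ (λ B A → (B + (c∪ + c∩)) - A) (weight-modular b Y₁ Y₂) (weight-modular a X₁ X₂) ⟩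
    ((b₁ + b₂) + (c∪ + c∩)) - (a₁ + a₂)
      ≤⟨ ℤP.+-monoˡ-≤ (- (a₁ + a₂)) (ℤP.+-monoʳ-≤ (b₁ + b₂) (cut-submodular M X₁ X₂ Y₁ Y₂)) ⟩
    ((b₁ + b₂) + (c₁ + c₂)) - (a₁ + a₂)
      ≡⟨ regroup b₁ b₂ c₁ c₂ a₁ a₂ ⟨
    ((b₁ + c₁) - a₁) + ((b₂ + c₂) - a₂) ∎
    where
    open ℤP.≤-Reasoning
    regroup : ∀ b b′ c c′ a a′ → ((b + c) - a) + ((b′ + c′) - a′) ≡ ((b + b′) + (c + c′)) - (a + a′)
    regroup = solve-∀
    a∪ = weight a (X₁ ∪ X₂); a∩ = weight a (X₁ ∩ X₂); a₁ = weight a X₁; a₂ = weight a X₂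
    b∪ = weight b (Y₁ ∪ Y₂); b∩ = weight b (Y₁ ∩ Y₂); b₁ = weight b Y₁; b₂ = weight b Y₂
    c∪ = cut M (X₁ ∪ X₂) (Y₁ ∪ Y₂); c∩ = cut M (X₁ ∩ X₂) (Y₁ ∩ Y₂)
    c₁ = cut M X₁ Y₁; c₂ = cut M X₂ Y₂

  slack-↓ : ∀ {m n} (M : BoolMatrix m n) a b u v X Y →
            slack M (a ↓ u) (b ↓ v) X Y ≡ slack M a b X Y + ([ X u ]ℤ - [ Y v ]ℤ)
  slack-↓ M a b u v X Y =
    trans (cong₂ (λ B A → (B + cut M X Y) - A) (weight-↓ b v Y) (weight-↓ a u X))
          (rearrange (weight b Y) (cut M X Y) (weight a X) [ X u ]ℤ [ Y v ]ℤ)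
    where
    rearrange : ∀ B c A x y → ((B - y) + c) - (A - x) ≡ ((B + c) - A) + (x - y)
    rearrange = solve-∀

  module _ {m n : ℕ} (M : BoolMatrix m n) {u : Fin m} {v : Fin n} (Muv : M u v ≡ true) where

    count-remove : count M ≡ suc (count (M ∖⟨ u , v ⟩))
    count-remove = ℕΣ.supportSum-remove M (λ _ _ → 1) Muv

    slack-remove : ∀ a b X Y → slack M a b X Y ≡ slack (M ∖⟨ u , v ⟩) a b X Y + [ X u ∧ not (Y v) ]ℤ
    slack-remove a b X Y =
      trans (cong (λ c → (weight b Y + c) - weight a X) (ℤΣ.supportSum-remove M _ Muv))
            (rearrange (weight b Y) (cut (M ∖⟨ u , v ⟩) X Y) (weight a X) [ X u ∧ not (Y v) ]ℤ)
      where
      rearrange : ∀ B c A k → (B + (k + c)) - A ≡ ((B + c) - A) + k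
      rearrange = solve-∀

  cut-emptySupport : ∀ {m n} (M : BoolMatrix m n) → (∀ i j → M i j ≡ false) → ∀ X Y → cut M X Y ≡ 0ℤ
  cut-emptySupport {m} {n} M M-empty X Y =
    trans (ℤΣ.sum-cong-≗ λ i → trans (ℤΣ.sum-cong-≗ λ j →
             cong (λ μ → if μ then [ X i ∧ not (Y j) ]ℤ else 0ℤ) (M-empty i j)) (ℤΣ.sum-zero {n}))
          (ℤΣ.sum-zero {m})

  module _ {m n : ℕ} {M : BoolMatrix m n} {a : Fin m → ℤ} {b : Fin n → ℤ} where

    0≤slack : CutCondition M a b → ∀ X Y → 0ℤ ≤ slack M a b X Y
    0≤slack C X Y = ℤP.i≤j⇒0≤j-i (C X Y)

    slack-cong : ∀ {X X′ Y Y′} → (∀ i → X i ≡ X′ i) → (∀ j → Y j ≡ Y′ j) → slack M a b X Y ≡ slack M a b X′ Y′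
    slack-cong X≗X′ Y≗Y′ = cong₂ _-_ (cong₂ _+_ (weight-cong b Y≗Y′) cut-cong) (weight-cong a X≗X′)
      where
      weight-cong : ∀ {k} (c : Fin k → ℤ) {Z Z′ : VSet k} → (∀ i → Z i ≡ Z′ i) → weight c Z ≡ weight c Z′
      weight-cong c Z≗Z′ = ℤΣ.sum-cong-≗ (λ i → cong (λ z → if z then c i else 0ℤ) (Z≗Z′ i))
      cut-cong = ℤΣ.sum-cong-≗ λ i → ℤΣ.sum-cong-≗ λ j →
        cong₂ (λ x y → if M i j then [ x ∧ not y ]ℤ else 0ℤ) (X≗X′ i) (Y≗Y′ j)

    cutCondition? : CutCondition M a b ⊎ ∃₂ λ X Y → slack M a b X Y < 0ℤ
    cutCondition? with anySubset? (λ X → anySubset? (λ Y → ¬? (0ℤ ℤP.≤? slack M a b (lookup X) (lookup Y))))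
    ... | yes (X , Y , 0≰s) = inj₂ (lookup X , lookup Y , ℤP.≰⇒> 0≰s)
    ... | no no-violation = inj₁ λ X Y →
      ℤP.0≤i-j⇒j≤i (subst (0ℤ ≤_) (slack-cong (lookup∘tabulate X) (lookup∘tabulate Y))
        (decidable-stable (0ℤ ℤP.≤? _) λ 0≰s → no-violation (tabulate X , tabulate Y , 0≰s)))

    emptySupport⇒zero-margins : (∀ i j → M i j ≡ false) → ℤΣ.sum a ≡ ℤΣ.sum b → CutCondition M a b →
                                (∀ i → a i ≡ 0ℤ) × (∀ j → b j ≡ 0ℤ)
    emptySupport⇒zero-margins M-empty Σa≡Σb C =
      (λ i → ℤP.≤-antisym (a≤0 i) (0≤a i)) , (λ j → ℤP.≤-antisym (b≤0 j) (0≤b j))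
      where
      open ℤP.≤-Reasoning
      none all : ∀ {k} → VSet k
      none _ = false
      all  _ = true
      C₀ : ∀ X Y → weight a X ≤ weight b Y
      C₀ X Y = subst (weight a X ≤_) (trans (cong (λ z → weight b Y + z) (cut-emptySupport M M-empty X Y))
                                            (ℤP.+-identityʳ _)) (C X Y)
      a≤0 : ∀ i → a i ≤ 0ℤ
      a≤0 i = subst₂ _≤_ (weight-single a i) (ℤΣ.sum-zero {n}) (C₀ (λ j → does (i ≟ j)) none)
      0≤b : ∀ j → 0ℤ ≤ b j
      0≤b j = subst₂ _≤_ (ℤΣ.sum-zero {m}) (weight-single b j) (C₀ none (λ i → does (j ≟ i)))
      0≤a : ∀ i → 0ℤ ≤ a i
      0≤a i = ℤ+-cancelʳ-≤ (weight a ¬i) (begin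
        0ℤ + weight a ¬i                              ≡⟨ ℤP.+-identityˡ _ ⟩
        weight a ¬i                                   ≤⟨ C₀ ¬i all ⟩
        ℤΣ.sum b                                      ≡⟨ Σa≡Σb ⟨
        ℤΣ.sum a                                      ≡⟨ weight-complement a (λ j → does (i ≟ j)) ⟨
        weight a (λ j → does (i ≟ j)) + weight a ¬i   ≡⟨ cong (λ z → z + weight a ¬i) (weight-single a i) ⟩
        a i + weight a ¬i                             ∎)
        where
        ¬i : VSet m
        ¬i j = not (does (i ≟ j))
      b≤0 : ∀ j → b j ≤ 0ℤ
      b≤0 j = ℤ+-cancelʳ-≤ (weight b ¬j) (begin
        b j + weight b ¬j                             ≡⟨ cong (λ z → z + weight b ¬j) (weight-single b j) ⟨
        weight b (λ i → does (j ≟ i)) + weight b ¬j   ≡⟨ weight-complement b (λ i → does (j ≟ i)) ⟩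
        ℤΣ.sum b                                      ≡⟨ Σa≡Σb ⟨
        ℤΣ.sum a                                      ≤⟨ C₀ all ¬j ⟩
        weight b ¬j                                   ≡⟨ ℤP.+-identityˡ _ ⟨
        0ℤ + weight b ¬j                              ∎)
        where
        ¬j : VSet n
        ¬j i = not (does (j ≟ i))

    realisation-emptySupport : (∀ i j → M i j ≡ false) → ℤΣ.sum a ≡ ℤΣ.sum b → CutCondition M a b →
                               Realisation M a b
    realisation-emptySupport M-empty Σa≡Σb C = record
      { matrix   = λ _ _ → false
      ; ⊆support = λ _ _ ()
      ; row-sums = λ i → trans (ℤΣ.sum-zero {n}) (sym (proj₁ zero-margins i))
      ; col-sums = λ j → trans (ℤΣ.sum-zero {m}) (sym (proj₂ zero-margins j))
      }
      where zero-margins = emptySupport⇒zero-margins M-empty Σa≡Σb C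

  private
    tight-at-cell : ∀ {s} x y → s < 0ℤ → 0ℤ ≤ s + [ x ∧ not y ]ℤ → x ≡ true × y ≡ false
    tight-at-cell true  false _   _   = refl , refl
    tight-at-cell true  true  s<0 0≤s = ⊥-elim (ℤP.<⇒≱ s<0 (subst (0ℤ ≤_) (ℤP.+-identityʳ _) 0≤s))
    tight-at-cell false _     s<0 0≤s = ⊥-elim (ℤP.<⇒≱ s<0 (subst (0ℤ ≤_) (ℤP.+-identityʳ _) 0≤s))

    tight-at-decrement : ∀ {s} x y → s + ([ x ]ℤ - [ y ]ℤ) < 0ℤ → 0ℤ ≤ s + [ x ∧ not y ]ℤ →
                         x ≡ false × y ≡ true
    tight-at-decrement false true  _   _   = refl , refl
    tight-at-decrement true  true  s<0 0≤s = ⊥-elim (ℤP.<⇒≱ s<0 0≤s)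
    tight-at-decrement true  false s<0 0≤s = ⊥-elim (ℤP.<⇒≱ s<0 0≤s)
    tight-at-decrement false false s<0 0≤s = ⊥-elim (ℤP.<⇒≱ s<0 0≤s)

    uncrossing-contradiction :
      ∀ {s₁ s₂ s∪ s∩} x₁ y₁ x₂ y₂ →
      s₁ < 0ℤ → 0ℤ ≤ s₁ + [ x₁ ∧ not y₁ ]ℤ →
      s₂ + ([ x₂ ]ℤ - [ y₂ ]ℤ) < 0ℤ → 0ℤ ≤ s₂ + [ x₂ ∧ not y₂ ]ℤ →
      0ℤ ≤ s∪ + [ (x₁ ∨ x₂) ∧ not (y₁ ∨ y₂) ]ℤ →
      0ℤ ≤ s∩ + [ (x₁ ∧ x₂) ∧ not (y₁ ∧ y₂) ]ℤ →
      s∪ + s∩ ≤ s₁ + s₂ → ⊥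
    uncrossing-contradiction {s₁} {s₂} {s∪} {s∩} x₁ y₁ x₂ y₂ s₁<0 c₁ s₂′<0 c₂ c∪ c∩ sub
      with tight-at-cell {s₁} x₁ y₁ s₁<0 c₁ | tight-at-decrement {s₂} x₂ y₂ s₂′<0 c₂
    ... | refl , refl | refl , refl = ℤP.<-irrefl refl (begin-strict
      0ℤ       ≤⟨ ℤP.+-mono-≤ (drop-0 {s∪} c∪) (drop-0 {s∩} c∩) ⟩
      s∪ + s∩  ≤⟨ sub ⟩
      s₁ + s₂  <⟨ ℤP.+-mono-<-≤ s₁<0 s₂≤0 ⟩
      0ℤ       ∎)
      where
      open ℤP.≤-Reasoning
      drop-0 : ∀ {s} → 0ℤ ≤ s + 0ℤ → 0ℤ ≤ s
      drop-0 {s} = subst (0ℤ ≤_) (ℤP.+-identityʳ s)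
      s₂≤0 : s₂ ≤ 0ℤ
      s₂≤0 = subst (_≤ 0ℤ) (undo s₂) (ℤP.i<j⇒suc[i]≤j s₂′<0)
        where
        undo : ∀ s → 1ℤ + (s + - 1ℤ) ≡ s
        undo = solve-∀

  no-double-violation :
    ∀ {m n} (M : BoolMatrix m n) {u v} → M u v ≡ true → ∀ {a b} → CutCondition M a b →
    ∀ X₁ Y₁ X₂ Y₂ → slack (M ∖⟨ u , v ⟩) a b X₁ Y₁ < 0ℤ →
    slack (M ∖⟨ u , v ⟩) (a ↓ u) (b ↓ v) X₂ Y₂ < 0ℤ → ⊥
  no-double-violation M {u} {v} Muv {a} {b} C X₁ Y₁ X₂ Y₂ viol₁ viol₂ =
    uncrossing-contradiction
      {slack M′ a b X₁ Y₁} {slack M′ a b X₂ Y₂}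
      {slack M′ a b (X₁ ∪ X₂) (Y₁ ∪ Y₂)} {slack M′ a b (X₁ ∩ X₂) (Y₁ ∩ Y₂)}
      (X₁ u) (Y₁ v) (X₂ u) (Y₂ v)
      viol₁ (C′ X₁ Y₁) (subst (_< 0ℤ) (slack-↓ M′ a b u v X₂ Y₂) viol₂) (C′ X₂ Y₂)
      (C′ (X₁ ∪ X₂) (Y₁ ∪ Y₂)) (C′ (X₁ ∩ X₂) (Y₁ ∩ Y₂)) (slack-submodular M′ a b X₁ X₂ Y₁ Y₂)
    where
    M′ = M ∖⟨ u , v ⟩
    C′ : ∀ X Y → 0ℤ ≤ slack M′ a b X Y + [ X u ∧ not (Y v) ]ℤ
    C′ X Y = subst (0ℤ ≤_) (slack-remove M Muv a b X Y) (0≤slack {M = M} C X Y)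

  module _ {m n : ℕ} where

    realisation-weaken : ∀ {M M′ : BoolMatrix m n} {a b} → (∀ i j → M i j ≡ true → M′ i j ≡ true) →
                         Realisation M a b → Realisation M′ a b
    realisation-weaken M⊆M′ R = record
      { matrix = matrix ; ⊆support = λ i j φij → M⊆M′ i j (⊆support i j φij)
      ; row-sums = row-sums ; col-sums = col-sums }
      where open Realisation R

    realisation-add-cell : ∀ (M : BoolMatrix m n) {u v a b} → M u v ≡ true →
                           Realisation (M ∖⟨ u , v ⟩) (a ↓ u) (b ↓ v) → Realisation M a b
    realisation-add-cell M {u} {v} {a} {b} Muv R = record
      { matrix   = ψ
      ; ⊆support = ψ⊆M
      ; row-sums = λ i → begin
          rowSum ψ i
            ≡⟨ ℤΣ.sum-cong-≗ (λ j → split i j) ⟩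
          ℤΣ.sum (λ j → [ φ i j ]ℤ + [ cell i j ]ℤ)
            ≡⟨ ℤΣ.∑-distrib-+ (λ j → [ φ i j ]ℤ) (λ j → [ cell i j ]ℤ) ⟩
          rowSum φ i + ℤΣ.sum (λ j → [ cell i j ]ℤ)
            ≡⟨ cong₂ _+_ (row-sums i) (line (does (u ≟ i)) v) ⟩
          (a i - [ does (u ≟ i) ]ℤ) + [ does (u ≟ i) ]ℤ
            ≡⟨ cancel (a i) _ ⟩
          a i ∎
      ; col-sums = λ j → begin
          colSum ψ j
            ≡⟨ ℤΣ.sum-cong-≗ (λ i → split i j) ⟩
          ℤΣ.sum (λ i → [ φ i j ]ℤ + [ cell i j ]ℤ)
            ≡⟨ ℤΣ.∑-distrib-+ (λ i → [ φ i j ]ℤ) (λ i → [ cell i j ]ℤ) ⟩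
          colSum φ j + ℤΣ.sum (λ i → [ cell i j ]ℤ)
            ≡⟨ cong₂ _+_ (col-sums j) (trans (ℤΣ.sum-cong-≗ λ i → cong [_]ℤ (∧-comm (does (u ≟ i)) (does (v ≟ j))))
                                             (line (does (v ≟ j)) u)) ⟩
          (b j - [ does (v ≟ j) ]ℤ) + [ does (v ≟ j) ]ℤ
            ≡⟨ cancel (b j) _ ⟩
          b j ∎
      }
      where
      open Realisation R renaming (matrix to φ)
      open ≡-Reasoning
      cell ψ : BoolMatrix m n
      cell i j = does (u ≟ i) ∧ does (v ≟ j)
      ψ i j = φ i j ∨ cell i j
      ψ⊆M : ∀ i j → ψ i j ≡ true → M i j ≡ true
      ψ⊆M i j ψij with φ i j in φij
      ... | true  = ∧-conicalˡ (M i j) _ (⊆support i j φij)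
      ... | false = cell⇒support M i j Muv ψij
      split : ∀ i j → [ ψ i j ]ℤ ≡ [ φ i j ]ℤ + [ cell i j ]ℤ
      split i j with φ i j in φij
      ... | false = sym (ℤP.+-identityˡ _)
      ... | true  = sym (cong (λ c → 1ℤ + [ c ]ℤ) (∧-not-conicalʳ (M i j) (cell i j) (⊆support i j φij)))
      line : ∀ {k} d (w : Fin k) → ℤΣ.sum (λ j → [ d ∧ does (w ≟ j) ]ℤ) ≡ [ d ]ℤ
      line {k} false w = ℤΣ.sum-zero {k}
      line     true  w = ℤΣ.sum-single w (λ _ → 1ℤ)
      cancel : ∀ x y → (x - y) + y ≡ x
      cancel = solve-∀

    find-cell : (M : BoolMatrix m n) → (∃₂ λ u v → M u v ≡ true) ⊎ (∀ i j → M i j ≡ false)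
    find-cell M with any? (λ u → any? (λ v → M u v Bool.≟ true))
    ... | yes (u , v , Muv) = inj₁ (u , v , Muv)
    ... | no none           = inj₂ λ i j → ¬-not (λ Mij → none (i , j , Mij))

    private
      realise : ∀ k (M : BoolMatrix m n) a b → count M ℕ.< k →
                ℤΣ.sum a ≡ ℤΣ.sum b → CutCondition M a b → Realisation M a b
      realise (suc k) M a b (s≤s count≤k) Σa≡Σb C with find-cell M
      ... | inj₂ M-empty       = realisation-emptySupport M-empty Σa≡Σb C
      ... | inj₁ (u , v , Muv) = at-cell
        where
        M′ = M ∖⟨ u , v ⟩
        count′<k : count M′ ℕ.< k
        count′<k = subst (ℕ._≤ k) (count-remove M Muv) count≤k
        Σa↓≡Σb↓ : ℤΣ.sum (a ↓ u) ≡ ℤΣ.sum (b ↓ v)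
        Σa↓≡Σb↓ = trans (weight-↓ a u (λ _ → true))
                    (trans (cong (_- 1ℤ) Σa≡Σb) (sym (weight-↓ b v (λ _ → true))))
        at-cell : Realisation M a b
        at-cell with cutCondition? {M = M′} {a} {b} | cutCondition? {M = M′} {a ↓ u} {b ↓ v}
        ... | inj₁ C′ | _ =
          realisation-weaken (λ i j → ∧-conicalˡ (M i j) _) (realise k M′ a b count′<k Σa≡Σb C′)
        ... | inj₂ _ | inj₁ C″ =
          realisation-add-cell M Muv (realise k M′ (a ↓ u) (b ↓ v) count′<k Σa↓≡Σb↓ C″)
        ... | inj₂ (X₁ , Y₁ , viol₁) | inj₂ (X₂ , Y₂ , viol₂) =
          ⊥-elim (no-double-violation M Muv C X₁ Y₁ X₂ Y₂ viol₁ viol₂)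

    cutCondition⇒realisation : ∀ (M : BoolMatrix m n) a b → ℤΣ.sum a ≡ ℤΣ.sum b → CutCondition M a b →
                               Realisation M a b
    cutCondition⇒realisation M a b = realise (suc (count M)) M a b (ℕP.n<1+n (count M))

module GraphCuts where

  open import Data.Integer as ℤ using (ℤ; +_; 0ℤ; _+_; _-_; -_; _≤_)
  open import Data.Integer.Tactic.RingSolver using (solve-∀)
  open Margins

  pos-sumℕ : ∀ {n} (f : Fin n → ℕ) → + sumℕ f ≡ ℤΣ.sum (λ i → + f i)
  pos-sumℕ {zero}  f = refl
  pos-sumℕ {suc n} f = trans (ℤP.pos-+ (f zero) _) (cong (λ s → + f zero + s) (pos-sumℕ (λ i → f (suc i))))

  pos-setSum : ∀ {n} (φ : Fin n → ℕ) S → + setSum φ S ≡ weight (λ i → + φ i) S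
  pos-setSum φ S = trans (pos-sumℕ (λ x → if S x then φ x else 0)) (ℤΣ.sum-cong-≗ λ i → pointwise (S i))
    where
    pointwise : ∀ b {x} → + (if b then x else 0) ≡ (if b then + x else 0ℤ)
    pointwise true  = refl
    pointwise false = refl

  pos-count : ∀ {n} (c : Fin n → Bool) → + sumℕ (λ j → [ c j ]) ≡ ℤΣ.sum (λ j → [ c j ]ℤ)
  pos-count c = trans (pos-sumℕ (λ j → [ c j ])) (ℤΣ.sum-cong-≗ λ j → pos-[] (c j))
    where
    pos-[] : ∀ b → + [ b ] ≡ [ b ]ℤ
    pos-[] true  = refl
    pos-[] false = refl

  _∖_ : ∀ {n} → VSet n → VSet n → VSet n
  (X ∖ Y) i = X i ∧ not (Y i)

  ∖-disjoint : ∀ {n} (X Y : VSet n) → Disjoint (Y ∖ X) (X ∖ Y)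
  ∖-disjoint X Y i Yi∧¬Xi with X i | Y i
  ∖-disjoint X Y i () | true  | true
  ∖-disjoint X Y i () | true  | false
  ∖-disjoint X Y i _  | false | _     = refl

  Disjoint-sym : ∀ {n} {S T : VSet n} → Disjoint S T → Disjoint T S
  Disjoint-sym {S = S} S∩T=∅ i Ti with S i in Si
  ... | false = refl
  ... | true  = case trans (sym Ti) (S∩T=∅ i Si) of λ ()

  weight-sub : ∀ {n} (a b : Fin n → ℤ) X → weight (λ i → a i - b i) X ≡ weight a X - weight b X
  weight-sub a b X =
    trans (ℤΣ.sum-cong-≗ λ i → pointwise (X i))
          (ℤsum-sub (λ i → if X i then a i else 0ℤ) (λ i → if X i then b i else 0ℤ))
    where
    pointwise : ∀ x {c d} → (if x then c - d else 0ℤ) ≡ (if x then c else 0ℤ) - (if x then d else 0ℤ)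
    pointwise true  = refl
    pointwise false = refl

  weight-mono : ∀ {n} {a b : Fin n → ℤ} X → (∀ i → X i ≡ true → a i ≤ b i) → weight a X ≤ weight b X
  weight-mono X a≤b = ℤsum-mono λ i → pointwise (X i) (a≤b i)
    where
    pointwise : ∀ x {c d} → (x ≡ true → c ≤ d) → (if x then c else 0ℤ) ≤ (if x then d else 0ℤ)
    pointwise true  c≤d = c≤d refl
    pointwise false _   = ℤP.≤-refl

  weight-difference : ∀ {n} (a : Fin n → ℤ) X Y → weight a X - weight a Y ≡ weight a (X ∖ Y) - weight a (Y ∖ X)
  weight-difference a X Y =
    trans (sym (ℤsum-sub (restrict X) (restrict Y)))
          (trans (ℤΣ.sum-cong-≗ λ i → pointwise (X i) (Y i) (a i)) (ℤsum-sub (restrict (X ∖ Y)) (restrict (Y ∖ X))))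
    where
    restrict : VSet _ → Fin _ → ℤ
    restrict Z i = if Z i then a i else 0ℤ
    pointwise : ∀ x y c → (if x then c else 0ℤ) - (if y then c else 0ℤ)
                          ≡ (if x ∧ not y then c else 0ℤ) - (if y ∧ not x then c else 0ℤ)
    pointwise true  true  c = ℤP.+-inverseʳ c
    pointwise true  false c = refl
    pointwise false true  c = refl
    pointwise false false c = refl

  cut-antisymmetric-≤ : ∀ {n} (M : BoolMatrix n n) → (∀ i j → M i j ≡ M j i) →
                        ∀ X Y → cut M (X ∖ Y) (Y ∖ X) ≤ cut M X Y
  cut-antisymmetric-≤ {n} M M-sym X Y = begin
    cut M (X ∖ Y) (Y ∖ X)
      ≡⟨ ℤΣ.sum-cong-≗ (λ i → ℤΣ.sum-cong-≗ λ j → split (M i j) (X i) (Y i) (X j) (Y j)) ⟩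
    ℤΣ.sum₂ (λ i j → P i j + Q i j)
      ≡⟨ ℤΣ.sum₂-distrib-+ P Q ⟩
    ℤΣ.sum₂ P + ℤΣ.sum₂ Q
      ≡⟨ cong (λ z → ℤΣ.sum₂ P + z) Q-transpose ⟩
    ℤΣ.sum₂ P + ℤΣ.sum₂ Qᵀ
      ≡⟨ ℤΣ.sum₂-distrib-+ P Qᵀ ⟨
    ℤΣ.sum₂ (λ i j → P i j + Qᵀ i j)
      ≤⟨ ℤsum-mono (λ i → ℤsum-mono λ j → bound (M i j) (X i) (Y i) (X j) (Y j)) ⟩
    cut M X Y ∎
    where
    open ℤP.≤-Reasoning
    P Q Qᵀ : Fin n → Fin n → ℤ
    P  i j = if M i j then [ (X i ∧ not (Y i)) ∧ not (Y j) ]ℤ else 0ℤ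
    Q  i j = if M i j then [ (X i ∧ not (Y i)) ∧ (X j ∧ Y j) ]ℤ else 0ℤ
    Qᵀ i j = if M i j then [ (X i ∧ Y i) ∧ (X j ∧ not (Y j)) ]ℤ else 0ℤ
    Q-transpose : ℤΣ.sum₂ Q ≡ ℤΣ.sum₂ Qᵀ
    Q-transpose = trans (ℤΣ.∑-comm Q) (ℤΣ.sum-cong-≗ λ i → ℤΣ.sum-cong-≗ λ j →
      cong₂ (λ μ c → if μ then [ c ]ℤ else 0ℤ) (M-sym j i) (∧-comm (X j ∧ not (Y j)) (X i ∧ Y i)))
    split : ∀ μ xᵢ yᵢ xⱼ yⱼ → (if μ then [ (xᵢ ∧ not yᵢ) ∧ not (yⱼ ∧ not xⱼ) ]ℤ else 0ℤ)
            ≡ (if μ then [ (xᵢ ∧ not yᵢ) ∧ not yⱼ ]ℤ else 0ℤ)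
              + (if μ then [ (xᵢ ∧ not yᵢ) ∧ (xⱼ ∧ yⱼ) ]ℤ else 0ℤ)
    split false _     _     _     _     = refl
    split true  false _     _     _     = refl
    split true  true  true  _     _     = refl
    split true  true  false true  true  = refl
    split true  true  false true  false = refl
    split true  true  false false true  = refl
    split true  true  false false false = refl
    bound : ∀ μ xᵢ yᵢ xⱼ yⱼ → (if μ then [ (xᵢ ∧ not yᵢ) ∧ not yⱼ ]ℤ else 0ℤ)
                              + (if μ then [ (xᵢ ∧ yᵢ) ∧ (xⱼ ∧ not yⱼ) ]ℤ else 0ℤ)
                            ≤ (if μ then [ xᵢ ∧ not yⱼ ]ℤ else 0ℤ)
    bound false _     _     _     _     = ℤP.≤-refl
    bound true  false _     _     _     = ℤP.≤-refl
    bound true  true  false _     yⱼ    = ℤP.≤-reflexive (ℤP.+-identityʳ [ not yⱼ ]ℤ)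
    bound true  true  true  false true  = decideℤ _
    bound true  true  true  false false = decideℤ _
    bound true  true  true  true  true  = decideℤ _
    bound true  true  true  true  false = decideℤ _

  edgeDifference : ∀ {n} → Graph n → Graph n → BoolMatrix n n
  edgeDifference G H i j = adj G i j ∧ not (adj H i j)

  edgeDifference-sym : ∀ {n} (G H : Graph n) i j → edgeDifference G H i j ≡ edgeDifference G H j i
  edgeDifference-sym G H i j = cong₂ (λ g h → g ∧ not h) (Graph.sym G i j) (Graph.sym H i j)

  degMinus-as-sum₂ : ∀ {n} (G : Graph n) S T → Disjoint S T →
                     + setSum (degMinus G S) T ≡ ℤΣ.sum₂ (λ i j → [ T i ∧ (not (S j) ∧ adj G i j) ]ℤ)
  degMinus-as-sum₂ {n} G S T S∩T=∅ = trans (pos-setSum (degMinus G S) T) (ℤΣ.sum-cong-≗ row)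
    where
    row : ∀ i → (if T i then + degMinus G S i else 0ℤ) ≡ ℤΣ.sum (λ j → [ T i ∧ (not (S j) ∧ adj G i j) ]ℤ)
    row i with T i in Ti
    ... | false = sym (ℤΣ.sum-zero {n})
    ... | true rewrite Disjoint-sym S∩T=∅ i Ti = pos-count (λ j → not (S j) ∧ adj G i j)

  deg-as-sum₂ : ∀ {n} (H : Graph n) T → + setSum (deg H) T ≡ ℤΣ.sum₂ (λ i j → [ T i ∧ adj H i j ]ℤ)
  deg-as-sum₂ {n} H T = trans (pos-setSum (deg H) T) (ℤΣ.sum-cong-≗ row)
    where
    row : ∀ i → (if T i then + deg H i else 0ℤ) ≡ ℤΣ.sum (λ j → [ T i ∧ adj H i j ]ℤ)
    row i with T i
    ... | false = sym (ℤΣ.sum-zero {n})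
    ... | true  = pos-count (adj H i)

  eBetween-as-sum₂ : ∀ {n} (H : Graph n) S T → + eBetween H S T ≡ ℤΣ.sum₂ (λ i j → [ S j ∧ (T i ∧ adj H i j) ]ℤ)
  eBetween-as-sum₂ H S T = begin
    + eBetween H S T
      ≡⟨ trans (pos-sumℕ (λ i → sumℕ (λ j → [ S i ∧ (T j ∧ adj H i j) ])))
               (ℤΣ.sum-cong-≗ λ i → pos-count (λ j → S i ∧ (T j ∧ adj H i j))) ⟩
    ℤΣ.sum₂ (λ i j → [ S i ∧ (T j ∧ adj H i j) ]ℤ)
      ≡⟨ ℤΣ.∑-comm (λ i j → [ S i ∧ (T j ∧ adj H i j) ]ℤ) ⟩
    ℤΣ.sum₂ (λ i j → [ S j ∧ (T i ∧ adj H j i) ]ℤ)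
      ≡⟨ ℤΣ.sum-cong-≗ (λ i → ℤΣ.sum-cong-≗ λ j → cong (λ h → [ S j ∧ (T i ∧ h) ]ℤ) (Graph.sym H j i)) ⟩
    ℤΣ.sum₂ (λ i j → [ S j ∧ (T i ∧ adj H i j) ]ℤ) ∎
    where open ≡-Reasoning

  degMinus-identity : ∀ {n} (G H : Graph n) → H ⊆G G → ∀ S T → Disjoint S T →
    + setSum (degMinus G S) T + + eBetween H S T ≡ + setSum (deg H) T + cut (edgeDifference G H) T S
  degMinus-identity {n} G H H⊆G S T S∩T=∅ = begin
    + setSum (degMinus G S) T + + eBetween H S T
      ≡⟨ cong₂ _+_ (degMinus-as-sum₂ G S T S∩T=∅) (eBetween-as-sum₂ H S T) ⟩
    ℤΣ.sum₂ A + ℤΣ.sum₂ B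
      ≡⟨ ℤΣ.sum₂-distrib-+ A B ⟨
    ℤΣ.sum₂ (λ i j → A i j + B i j)
      ≡⟨ ℤΣ.sum-cong-≗ (λ i → ℤΣ.sum-cong-≗ λ j → pointwise (T i) (S j) (adj G i j) (adj H i j) (H⊆G i j)) ⟩
    ℤΣ.sum₂ (λ i j → C i j + D i j)
      ≡⟨ ℤΣ.sum₂-distrib-+ C D ⟩
    ℤΣ.sum₂ C + ℤΣ.sum₂ D
      ≡⟨ cong (λ z → z + ℤΣ.sum₂ D) (deg-as-sum₂ H T) ⟨
    + setSum (deg H) T + cut (edgeDifference G H) T S ∎
    where
    open ≡-Reasoning
    A B C D : Fin n → Fin n → ℤ
    A i j = [ T i ∧ (not (S j) ∧ adj G i j) ]ℤ
    B i j = [ S j ∧ (T i ∧ adj H i j) ]ℤ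
    C i j = [ T i ∧ adj H i j ]ℤ
    D i j = if adj G i j ∧ not (adj H i j) then [ T i ∧ not (S j) ]ℤ else 0ℤ
    pointwise : ∀ t s g h → (h ≡ true → g ≡ true) →
                [ t ∧ (not s ∧ g) ]ℤ + [ s ∧ (t ∧ h) ]ℤ
                ≡ [ t ∧ h ]ℤ + (if g ∧ not h then [ t ∧ not s ]ℤ else 0ℤ)
    pointwise _     _     false true  h⇒g = case h⇒g refl of λ ()
    pointwise true  true  true  true  _   = refl
    pointwise true  true  true  false _   = refl
    pointwise true  true  false false _   = refl
    pointwise true  false true  true  _   = refl
    pointwise true  false true  false _   = refl
    pointwise true  false false false _   = refl
    pointwise false true  true  true  _   = refl
    pointwise false true  true  false _   = refl
    pointwise false true  false false _   = refl
    pointwise false false true  true  _   = refl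
    pointwise false false true  false _   = refl
    pointwise false false false false _   = refl

  excess : ∀ {n} → Graph n → (Fin n → ℕ) → Fin n → ℤ
  excess H r i = + r i - + deg H i

  weight-excess : ∀ {n} (H : Graph n) r X → weight (excess H r) X ≡ + setSum r X - + setSum (deg H) X
  weight-excess H r X = trans (weight-sub (λ i → + r i) (λ i → + deg H i) X)
                              (sym (cong₂ _-_ (pos-setSum r X) (pos-setSum (deg H) X)))

  weight-excess-mono : ∀ {n} (H : Graph n) {r r′} → (∀ x → r x ℕ.≤ r′ x) →
                       ∀ X → weight (excess H r) X ≤ weight (excess H r′) X
  weight-excess-mono H r≤r′ X = weight-mono X (λ i _ → ℤP.+-monoˡ-≤ (- + deg H i) (ℤ.+≤+ (r≤r′ i)))

  excess-count : ∀ {k d r : ℕ} → + k ≡ + r - + d → d ℕ.+ k ≡ r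
  excess-count {k} {d} {r} k≡r-d = ℤP.+-injective (begin
    + (d ℕ.+ k)       ≡⟨ ℤP.pos-+ d k ⟩
    + d + + k         ≡⟨ cong (λ z → + d + z) k≡r-d ⟩
    + d + (+ r - + d) ≡⟨ cancel (+ d) (+ r) ⟩
    + r               ∎)
    where
    open ≡-Reasoning
    cancel : ∀ d r → d + (r - d) ≡ r
    cancel = solve-∀

  module _ {n} (G H : Graph n) (H⊆G : H ⊆G G) {g f r : Fin n → ℕ}
           (cond : ∀ S T → Disjoint S T → Condition G H g f S T)
           (g≤r : ∀ x → g x ℕ.≤ r x) (r≤f : ∀ x → r x ℕ.≤ f x) where

    condition⇒cutCondition : CutCondition (edgeDifference G H) (excess H r) (excess H r)
    condition⇒cutCondition X Y = begin
      weight a X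
        ≡⟨ split-off (weight a X) (weight a Y) ⟩
      weight a Y + (weight a X - weight a Y)
        ≡⟨ cong (λ z → weight a Y + z) (weight-difference a X Y) ⟩
      weight a Y + (weight a T - weight a S)
        ≤⟨ ℤP.+-monoʳ-≤ (weight a Y) (ℤP.+-mono-≤ aT≤ (ℤP.neg-mono-≤ aS≥)) ⟩
      weight a Y + ((fT - hT) - (gS - hS))
        ≤⟨ ℤP.+-monoʳ-≤ (weight a Y) (rearrange (cond S T (∖-disjoint X Y))) ⟩
      weight a Y + ((dT + eH) - hT)
        ≡⟨ cong (λ z → weight a Y + (z - hT)) (degMinus-identity G H H⊆G S T (∖-disjoint X Y)) ⟩
      weight a Y + ((hT + cut M T S) - hT)
        ≡⟨ cong (λ z → weight a Y + z) (cancel hT (cut M T S)) ⟩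
      weight a Y + cut M T S
        ≤⟨ ℤP.+-monoʳ-≤ (weight a Y) (cut-antisymmetric-≤ M (edgeDifference-sym G H) X Y) ⟩
      weight a Y + cut M X Y ∎
      where
      open ℤP.≤-Reasoning
      M = edgeDifference G H
      a = excess H r
      S = Y ∖ X
      T = X ∖ Y
      gS = + setSum g S
      hS = + setSum (deg H) S
      fT = + setSum f T
      hT = + setSum (deg H) T
      dT = + setSum (degMinus G S) T
      eH = + eBetween H S T
      split-off : ∀ x y → x ≡ y + (x - y)
      split-off = solve-∀
      cancel : ∀ h c → (h + c) - h ≡ c
      cancel = solve-∀
      rearrange : hS - eH ≤ (gS + dT) - fT → (fT - hT) - (gS - hS) ≤ (dT + eH) - hT
      rearrange c = subst₂ _≤_ (regroup hS eH gS dT fT hT) (ℤP.+-identityʳ _)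
                      (ℤP.+-monoʳ-≤ ((dT + eH) - hT) (ℤP.i≤j⇒i-j≤0 c))
        where
        regroup : ∀ hS eH gS dT fT hT → ((dT + eH) - hT) + ((hS - eH) - ((gS + dT) - fT)) ≡ (fT - hT) - (gS - hS)
        regroup = solve-∀
      aT≤ : weight a T ≤ fT - hT
      aT≤ = subst (weight a T ≤_) (weight-excess H f T) (weight-excess-mono H r≤f T)
      aS≥ : gS - hS ≤ weight a S
      aS≥ = subst (_≤ weight a S) (weight-excess H g S) (weight-excess-mono H g≤r S)

  condition-from-ℕ : ∀ {n} {G H : Graph n} {g f S T} →
    setSum (deg H) S ℕ.+ setSum f T ℕ.≤ (setSum g S ℕ.+ setSum (degMinus G S) T) ℕ.+ eBetween H S T →
    Condition G H g f S T
  condition-from-ℕ {G = G} {H} {g} {f} {S} {T} ineq = begin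
    + hS - + eH                              ≡⟨ cancelˡ (+ hS) (+ eH) (+ fT) ⟨
    (+ hS + + fT) - (+ eH + + fT)            ≡⟨ cong (λ z → z - (+ eH + + fT)) (ℤP.pos-+ hS fT) ⟨
    + (hS ℕ.+ fT) - (+ eH + + fT)            ≤⟨ ℤP.+-monoˡ-≤ (- (+ eH + + fT)) (ℤ.+≤+ ineq) ⟩
    + ((gS ℕ.+ dT) ℕ.+ eH) - (+ eH + + fT)   ≡⟨ cong (λ z → z - (+ eH + + fT))
                                                   (trans (ℤP.pos-+ (gS ℕ.+ dT) eH) (cong (λ z → z + + eH) (ℤP.pos-+ gS dT))) ⟩
    ((+ gS + + dT) + + eH) - (+ eH + + fT)   ≡⟨ cancelʳ (+ gS + + dT) (+ fT) (+ eH) ⟩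
    (+ gS + + dT) - + fT                     ∎
    where
    open ℤP.≤-Reasoning
    hS = setSum (deg H) S
    eH = eBetween H S T
    gS = setSum g S
    dT = setSum (degMinus G S) T
    fT = setSum f T
    cancelˡ : ∀ a b c → (a + c) - (b + c) ≡ a - b
    cancelˡ = solve-∀
    cancelʳ : ∀ a b c → (a + c) - (c + b) ≡ a - b
    cancelʳ = solve-∀

module FractionalFactors where

  open import Data.Integer as ℤ using (+_)
  import Data.Nat.Coprimality as Coprimality
  open import Data.Rational as ℚ using (ℚ; mkℚ; *≤*; 0ℚ; 1ℚ; ½; _+_; _*_; _≤_)
  open import Data.Rational.Solver using (module +-*-Solver)
  open Margins using (Realisation; cutCondition⇒realisation)
  open GraphCuts

  [_]ℚ : Bool → ℚ
  [ b ]ℚ = if b then 1ℚ else 0ℚ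

  decideℚ : {x y : ℚ} → True (x ℚP.≤? y) → x ≤ y
  decideℚ = toWitness

  ℚsum-mono : ∀ {n} {f g : Fin n → ℚ} → (∀ i → f i ≤ g i) → ℚΣ.sum f ≤ ℚΣ.sum g
  ℚsum-mono = ℚΣ.sum-mono (λ {x} → ℚP.≤-refl {x}) (λ {x y z w} → ℚP.+-mono-≤ {x} {y} {z} {w})

  sumℚ≡sum : ∀ {n} (f : Fin n → ℚ) → sumℚ f ≡ ℚΣ.sum f
  sumℚ≡sum {zero}  f = refl
  sumℚ≡sum {suc n} f = cong (λ s → f zero + s) (sumℚ≡sum (λ i → f (suc i)))

  half-double : ∀ q → ½ * (q + q) ≡ q
  half-double q = begin
    ½ * (q + q)    ≡⟨ ℚP.*-distribˡ-+ ½ q q ⟩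
    ½ * q + ½ * q  ≡⟨ ℚP.*-distribʳ-+ q ½ ½ ⟨
    (½ + ½) * q    ≡⟨ ℚP.*-identityˡ q ⟩
    q              ∎
    where open ≡-Reasoning

  ℕtoℚ≡mkℚ : ∀ k → ℕtoℚ k ≡ mkℚ (+ k) 0 (Coprimality.sym (Coprimality.1-coprimeTo k))
  ℕtoℚ≡mkℚ k = ℚP.normalize-coprime (Coprimality.sym (Coprimality.1-coprimeTo k))

  ℕtoℚ-+ : ∀ m n → ℕtoℚ (m ℕ.+ n) ≡ ℕtoℚ m + ℕtoℚ n
  ℕtoℚ-+ m n rewrite ℕtoℚ≡mkℚ m | ℕtoℚ≡mkℚ n =
    cong (λ z → z ℚ./ 1) (sym (trans (cong₂ ℤ._+_ (ℤP.*-identityʳ (+ m)) (ℤP.*-identityʳ (+ n))) (sym (ℤP.pos-+ m n))))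

  ℕtoℚ-cancel-≤ : ∀ {m n} → ℕtoℚ m ≤ ℕtoℚ n → m ℕ.≤ n
  ℕtoℚ-cancel-≤ {m} {n} m≤n rewrite ℕtoℚ≡mkℚ m | ℕtoℚ≡mkℚ n with m≤n
  ... | *≤* m*1≤n*1 = ℤP.drop‿+≤+ (subst₂ ℤ._≤_ (ℤP.*-identityʳ (+ m)) (ℤP.*-identityʳ (+ n)) m*1≤n*1)

  ℕtoℚ-sumℕ : ∀ {n} (f : Fin n → ℕ) → ℕtoℚ (sumℕ f) ≡ ℚΣ.sum (λ i → ℕtoℚ (f i))
  ℕtoℚ-sumℕ {zero}  f = refl
  ℕtoℚ-sumℕ {suc n} f = trans (ℕtoℚ-+ (f zero) _) (cong (λ s → ℕtoℚ (f zero) + s) (ℕtoℚ-sumℕ (λ i → f (suc i))))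

  ℕtoℚ-setSum : ∀ {n} (φ : Fin n → ℕ) X → ℕtoℚ (setSum φ X) ≡ ℚΣ.sum (λ i → if X i then ℕtoℚ (φ i) else 0ℚ)
  ℕtoℚ-setSum φ X = trans (ℕtoℚ-sumℕ (λ i → if X i then φ i else 0)) (ℚΣ.sum-cong-≗ λ i → pointwise (X i))
    where
    pointwise : ∀ b {k} → ℕtoℚ (if b then k else 0) ≡ (if b then ℕtoℚ k else 0ℚ)
    pointwise true  = refl
    pointwise false = refl

  ℕtoℚ-count : ∀ {n} (c : Fin n → Bool) → ℕtoℚ (sumℕ (λ j → [ c j ])) ≡ ℚΣ.sum (λ j → [ c j ]ℚ)
  ℕtoℚ-count c = trans (ℕtoℚ-sumℕ (λ j → [ c j ])) (ℚΣ.sum-cong-≗ λ j → ℕtoℚ-[] (c j))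
    where
    ℕtoℚ-[] : ∀ b → ℕtoℚ [ b ] ≡ [ b ]ℚ
    ℕtoℚ-[] true  = refl
    ℕtoℚ-[] false = refl

  private
    contraposition : ∀ {b c} → (b ≡ true → c ≡ true) → c ≡ false → b ≡ false
    contraposition {false} _   _       = refl
    contraposition {true}  b⇒c c≡false = case trans (sym (b⇒c refl)) c≡false of λ ()

    exclusion : ∀ {b c} → (b ≡ true → c ≡ false) → c ≡ true → b ≡ false
    exclusion {false} _    _      = refl
    exclusion {true}  b⇒¬c c≡true = case trans (sym (b⇒¬c refl)) c≡true of λ ()

  module _ {n} (G H : Graph n) (H⊆G : H ⊆G G) {r : Fin n → ℕ}
           (R : Realisation (edgeDifference G H) (excess H r) (excess H r)) where

    open Realisation R renaming (matrix to φ)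

    -- Row and column sums of φ are both r − d_H, so averaging φ with its transpose makes the
    -- G − H part of the factor symmetric without changing any degree.
    symmetrisedFactor : Fin n → Fin n → ℚ
    symmetrisedFactor x y = [ adj H x y ]ℚ + ½ * ([ φ x y ]ℚ + [ φ y x ]ℚ)

    private
      h = symmetrisedFactor

      φ⇒G : ∀ x y → φ x y ≡ true → adj G x y ≡ true
      φ⇒G x y φxy = ∧-conicalˡ (adj G x y) _ (⊆support x y φxy)

      φ⇒¬H : ∀ x y → φ x y ≡ true → adj H x y ≡ false
      φ⇒¬H x y φxy = ∧-not-conicalʳ (adj G x y) (adj H x y) (⊆support x y φxy)

      φᵀ⇒¬H : ∀ x y → φ y x ≡ true → adj H x y ≡ false
      φᵀ⇒¬H x y φyx = trans (Graph.sym H x y) (φ⇒¬H y x φyx)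

      h-sym : ∀ x y → h x y ≡ h y x
      h-sym x y = cong₂ (λ η s → [ η ]ℚ + ½ * s) (Graph.sym H x y) (ℚP.+-comm [ φ x y ]ℚ [ φ y x ]ℚ)

      h-bounds : ∀ x y → adj G x y ≡ true → 0ℚ ≤ h x y × h x y ≤ 1ℚ
      h-bounds x y _ = bounds (adj H x y) (φ x y) (φ y x) (φ⇒¬H x y) (φᵀ⇒¬H x y)
        where
        bounds : ∀ η p q → (p ≡ true → η ≡ false) → (q ≡ true → η ≡ false) →
                 0ℚ ≤ [ η ]ℚ + ½ * ([ p ]ℚ + [ q ]ℚ) × [ η ]ℚ + ½ * ([ p ]ℚ + [ q ]ℚ) ≤ 1ℚ
        bounds true  true  _     p⇒¬η _    = case p⇒¬η refl of λ ()
        bounds true  false true  _    q⇒¬η = case q⇒¬η refl of λ ()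
        bounds true  false false _    _    = decideℚ _ , decideℚ _
        bounds false true  true  _    _    = decideℚ _ , decideℚ _
        bounds false true  false _    _    = decideℚ _ , decideℚ _
        bounds false false true  _    _    = decideℚ _ , decideℚ _
        bounds false false false _    _    = decideℚ _ , decideℚ _

      h-on-H : ∀ x y → adj H x y ≡ true → h x y ≡ 1ℚ
      h-on-H x y Hxy rewrite Hxy | exclusion (φ⇒¬H x y) Hxy | exclusion (φᵀ⇒¬H x y) Hxy = refl

      h-off-G : ∀ x y → (if adj G x y then h x y else 0ℚ) ≡ h x y
      h-off-G x y with adj G x y in Gxy
      ... | true  = refl
      ... | false rewrite contraposition (H⊆G x y) Gxy
                        | contraposition (φ⇒G x y) Gxy
                        | contraposition (φ⇒G y x) (trans (Graph.sym G y x) Gxy) = refl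

      h-degree : ∀ x → sumℚ (λ y → if adj G x y then h x y else 0ℚ) ≡ ℕtoℚ (r x)
      h-degree x = begin
        sumℚ (λ y → if adj G x y then h x y else 0ℚ)
          ≡⟨ trans (sumℚ≡sum (λ y → if adj G x y then h x y else 0ℚ)) (ℚΣ.sum-cong-≗ (h-off-G x)) ⟩
        ℚΣ.sum (λ y → [ adj H x y ]ℚ + ½ * ([ φ x y ]ℚ + [ φ y x ]ℚ))
          ≡⟨ ℚΣ.∑-distrib-+ (λ y → [ adj H x y ]ℚ) (λ y → ½ * ([ φ x y ]ℚ + [ φ y x ]ℚ)) ⟩
        ℚΣ.sum (λ y → [ adj H x y ]ℚ) + ℚΣ.sum (λ y → ½ * ([ φ x y ]ℚ + [ φ y x ]ℚ))
          ≡⟨ cong₂ _+_ (ℕtoℚ-count (adj H x)) halve ⟨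
        ℕtoℚ (deg H x) + ½ * (ℕtoℚ row + ℕtoℚ column)
          ≡⟨ cong (λ c → ℕtoℚ (deg H x) + ½ * (ℕtoℚ row + ℕtoℚ c)) column≡row ⟩
        ℕtoℚ (deg H x) + ½ * (ℕtoℚ row + ℕtoℚ row)
          ≡⟨ cong (λ s → ℕtoℚ (deg H x) + s) (half-double (ℕtoℚ row)) ⟩
        ℕtoℚ (deg H x) + ℕtoℚ row
          ≡⟨ ℕtoℚ-+ (deg H x) row ⟨
        ℕtoℚ (deg H x ℕ.+ row)
          ≡⟨ cong ℕtoℚ deg+row≡r ⟩
        ℕtoℚ (r x) ∎
        where
        open ≡-Reasoning
        row column : ℕ
        row    = sumℕ (λ y → [ φ x y ])
        column = sumℕ (λ y → [ φ y x ])
        halve : ½ * (ℕtoℚ row + ℕtoℚ column) ≡ ℚΣ.sum (λ y → ½ * ([ φ x y ]ℚ + [ φ y x ]ℚ))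
        halve = trans (cong (½ *_) (trans (cong₂ _+_ (ℕtoℚ-count (φ x)) (ℕtoℚ-count (λ y → φ y x)))
                                          (sym (ℚΣ.∑-distrib-+ (λ y → [ φ x y ]ℚ) (λ y → [ φ y x ]ℚ)))))
                      (ℚΣ.sum-homo ℚ.+-0-rawMonoid (½ *_) (ℚP.*-zeroʳ ½) (ℚP.*-distribˡ-+ ½)
                                   (λ y → [ φ x y ]ℚ + [ φ y x ]ℚ))
        deg+row≡r : deg H x ℕ.+ row ≡ r x
        deg+row≡r = excess-count (trans (pos-count (φ x)) (row-sums x))
        column≡row : column ≡ row
        column≡row = ℕP.+-cancelˡ-≡ (deg H x) column row
          (trans (excess-count (trans (pos-count (λ y → φ y x)) (col-sums x))) (sym deg+row≡r))

    realisation⇒fractionalFactor : FractionalFactorIncluding G H r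
    realisation⇒fractionalFactor = h , h-sym , h-bounds , h-degree , h-on-H

  sufficiency : ∀ {n} (G H : Graph n) (g f : Fin n → ℕ) → H ⊆G G →
                (∀ S T → Disjoint S T → Condition G H g f S T) → AllFractionalFactorsIncluding G H g f
  sufficiency G H g f H⊆G cond r g≤r r≤f =
    realisation⇒fractionalFactor G H H⊆G
      (cutCondition⇒realisation (edgeDifference G H) (excess H r) (excess H r) refl
        (condition⇒cutCondition G H H⊆G cond g≤r r≤f))

  module EdgeWeights {n} (G H : Graph n) (H⊆G : H ⊆G G) {r : Fin n → ℕ} (F : FractionalFactorIncluding G H r) where

    private
      h = proj₁ F

    edgeWeight : Fin n → Fin n → ℚ
    edgeWeight x y = if adj G x y then h x y else 0ℚ

    edgeWeight-sym : ∀ x y → edgeWeight x y ≡ edgeWeight y x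
    edgeWeight-sym x y = cong₂ (λ b v → if b then v else 0ℚ) (Graph.sym G x y) (proj₁ (proj₂ F) x y)

    edgeWeight-degree : ∀ x → ℚΣ.sum (edgeWeight x) ≡ ℕtoℚ (r x)
    edgeWeight-degree x = trans (sym (sumℚ≡sum (edgeWeight x))) (proj₁ (proj₂ (proj₂ (proj₂ F))) x)

    H≤edgeWeight : ∀ x y → [ adj H x y ]ℚ ≤ edgeWeight x y
    H≤edgeWeight x y with adj H x y in Hxy | adj G x y in Gxy
    ... | true  | true  = ℚP.≤-reflexive (sym (proj₂ (proj₂ (proj₂ (proj₂ F))) x y Hxy))
    ... | true  | false = case trans (sym (H⊆G x y Hxy)) Gxy of λ ()
    ... | false | true  = proj₁ (proj₁ (proj₂ (proj₂ F)) x y Gxy)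
    ... | false | false = ℚP.≤-refl

    edgeWeight≤G : ∀ x y → edgeWeight x y ≤ [ adj G x y ]ℚ
    edgeWeight≤G x y with adj G x y in Gxy
    ... | true  = proj₂ (proj₁ (proj₂ (proj₂ F)) x y Gxy)
    ... | false = ℚP.≤-refl

  module _ {n} (G H : Graph n) (H⊆G : H ⊆G G) {g f : Fin n → ℕ} (S T : VSet n) (S∩T=∅ : Disjoint S T)
           (F : FractionalFactorIncluding G H (λ x → if T x then f x else g x)) where

    open EdgeWeights G H H⊆G {r = λ x → if T x then f x else g x} F

    private
      w = edgeWeight

      row-if : ∀ b {q} (c : Fin n → ℚ) → (b ≡ true → q ≡ ℚΣ.sum c) →
               (if b then q else 0ℚ) ≡ ℚΣ.sum (λ j → if b then c j else 0ℚ)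
      row-if true  c q≡Σc = q≡Σc refl
      row-if false c _    = sym (ℚΣ.sum-zero {n})

      A B C D E F′ : Fin n → Fin n → ℚ
      A  i j = if S i then [ adj H i j ]ℚ else 0ℚ
      B  i j = if T i then (if S j then 0ℚ else w i j) else 0ℚ
      C  i j = if T j then (if S i then w i j else 0ℚ) else 0ℚ
      D  i j = if S i then w i j else 0ℚ
      E  i j = if T i then [ not (S j) ∧ adj G i j ]ℚ else 0ℚ
      F′ i j = [ S i ∧ (T j ∧ adj H i j) ]ℚ

      hS≡ΣA : ℕtoℚ (setSum (deg H) S) ≡ ℚΣ.sum₂ A
      hS≡ΣA = trans (ℕtoℚ-setSum (deg H) S) (ℚΣ.sum-cong-≗ λ i →
                row-if (S i) (λ j → [ adj H i j ]ℚ) (λ _ → ℕtoℚ-count (adj H i)))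

      gS≡ΣD : ℕtoℚ (setSum g S) ≡ ℚΣ.sum₂ D
      gS≡ΣD = trans (ℕtoℚ-setSum g S) (ℚΣ.sum-cong-≗ λ i → row-if (S i) (w i) λ Si →
                trans (cong (λ t → ℕtoℚ (if t then f i else g i)) (sym (S∩T=∅ i Si)))
                      (sym (edgeWeight-degree i)))

      dT≡ΣE : ℕtoℚ (setSum (degMinus G S) T) ≡ ℚΣ.sum₂ E
      dT≡ΣE = trans (ℕtoℚ-setSum (degMinus G S) T) (ℚΣ.sum-cong-≗ λ i → row-if (T i) _ λ Ti →
                trans (cong (λ s → ℕtoℚ (if s then 0 else sumℕ (λ j → [ not (S j) ∧ adj G i j ])))
                            (Disjoint-sym S∩T=∅ i Ti))
                      (ℕtoℚ-count (λ j → not (S j) ∧ adj G i j)))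

      eH≡ΣF : ℕtoℚ (eBetween H S T) ≡ ℚΣ.sum₂ F′
      eH≡ΣF = trans (ℕtoℚ-sumℕ (λ i → sumℕ (λ j → [ S i ∧ (T j ∧ adj H i j) ])))
                    (ℚΣ.sum-cong-≗ λ i → ℕtoℚ-count (λ j → S i ∧ (T j ∧ adj H i j)))

      fT≡ΣB+ΣC : ℕtoℚ (setSum f T) ≡ ℚΣ.sum₂ B + ℚΣ.sum₂ C
      fT≡ΣB+ΣC = begin
        ℕtoℚ (setSum f T)
          ≡⟨ trans (ℕtoℚ-setSum f T) (ℚΣ.sum-cong-≗ λ i → row-if (T i) (w i) λ Ti →
               trans (cong (λ t → ℕtoℚ (if t then f i else g i)) (sym Ti)) (sym (edgeWeight-degree i))) ⟩
        ℚΣ.sum₂ (λ i j → if T i then w i j else 0ℚ)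
          ≡⟨ ℚΣ.sum-cong-≗ (λ i → ℚΣ.sum-cong-≗ λ j → split (T i) (S j) (w i j)) ⟩
        ℚΣ.sum₂ (λ i j → B i j + Cᵀ i j)
          ≡⟨ ℚΣ.sum₂-distrib-+ B Cᵀ ⟩
        ℚΣ.sum₂ B + ℚΣ.sum₂ Cᵀ
          ≡⟨ cong (λ z → ℚΣ.sum₂ B + z) (trans (ℚΣ.∑-comm Cᵀ) (ℚΣ.sum-cong-≗ λ i → ℚΣ.sum-cong-≗ λ j →
               cong (λ v → if T j then (if S i then v else 0ℚ) else 0ℚ) (edgeWeight-sym j i))) ⟩
        ℚΣ.sum₂ B + ℚΣ.sum₂ C ∎
        where
        open ≡-Reasoning
        Cᵀ : Fin n → Fin n → ℚ
        Cᵀ i j = if T i then (if S j then w i j else 0ℚ) else 0ℚ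
        split : ∀ t s v → (if t then v else 0ℚ)
                          ≡ (if t then (if s then 0ℚ else v) else 0ℚ) + (if t then (if s then v else 0ℚ) else 0ℚ)
        split true  true  v = sym (ℚP.+-identityˡ v)
        split true  false v = sym (ℚP.+-identityʳ v)
        split false _     v = refl

      S-rows : ℚΣ.sum₂ A + ℚΣ.sum₂ C ≤ ℚΣ.sum₂ D + ℚΣ.sum₂ F′
      S-rows = subst₂ _≤_ (ℚΣ.sum₂-distrib-+ A C) (ℚΣ.sum₂-distrib-+ D F′)
                 (ℚsum-mono λ i → ℚsum-mono λ j → cell (S i) (T j) (adj H i j) (H≤edgeWeight i j))
        where
        cell : ∀ s t η {v} → [ η ]ℚ ≤ v →
               (if s then [ η ]ℚ else 0ℚ) + (if t then (if s then v else 0ℚ) else 0ℚ)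
               ≤ (if s then v else 0ℚ) + [ s ∧ (t ∧ η) ]ℚ
        cell true  true  η {v} _   = ℚP.≤-reflexive (ℚP.+-comm [ η ]ℚ v)
        cell true  false η     η≤v = ℚP.+-monoˡ-≤ 0ℚ η≤v
        cell false true  _     _   = ℚP.≤-refl
        cell false false _     _   = ℚP.≤-refl

      T-rows : ℚΣ.sum₂ B ≤ ℚΣ.sum₂ E
      T-rows = ℚsum-mono λ i → ℚsum-mono λ j → cell (T i) (S j) (edgeWeight≤G i j)
        where
        cell : ∀ t s {v γ} → v ≤ [ γ ]ℚ →
               (if t then (if s then 0ℚ else v) else 0ℚ) ≤ (if t then [ not s ∧ γ ]ℚ else 0ℚ)
        cell true  false v≤γ = v≤γ
        cell true  true  _   = ℚP.≤-refl
        cell false _     _   = ℚP.≤-refl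

    factor⇒inequality :
      setSum (deg H) S ℕ.+ setSum f T ℕ.≤ (setSum g S ℕ.+ setSum (degMinus G S) T) ℕ.+ eBetween H S T
    factor⇒inequality = ℕtoℚ-cancel-≤ (begin
      ℕtoℚ (hS ℕ.+ fT)                          ≡⟨ ℕtoℚ-+ hS fT ⟩
      ℕtoℚ hS + ℕtoℚ fT                         ≡⟨ cong₂ _+_ hS≡ΣA fT≡ΣB+ΣC ⟩
      ΣA + (ΣB + ΣC)                            ≡⟨ solve 3 (λ a b c → a :+ (b :+ c) := (a :+ c) :+ b) refl ΣA ΣB ΣC ⟩
      (ΣA + ΣC) + ΣB                            ≤⟨ ℚP.+-mono-≤ S-rows T-rows ⟩
      (ΣD + ΣF) + ΣE                            ≡⟨ solve 3 (λ d e f → (d :+ f) :+ e := (d :+ e) :+ f) refl ΣD ΣE ΣF ⟩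
      (ΣD + ΣE) + ΣF                            ≡⟨ cong₂ _+_ (cong₂ _+_ gS≡ΣD dT≡ΣE) eH≡ΣF ⟨
      (ℕtoℚ gS + ℕtoℚ dT) + ℕtoℚ eH             ≡⟨ cong (λ z → z + ℕtoℚ eH) (ℕtoℚ-+ gS dT) ⟨
      ℕtoℚ (gS ℕ.+ dT) + ℕtoℚ eH                ≡⟨ ℕtoℚ-+ (gS ℕ.+ dT) eH ⟨
      ℕtoℚ ((gS ℕ.+ dT) ℕ.+ eH)                 ∎)
      where
      open ℚP.≤-Reasoning
      open +-*-Solver
      hS = setSum (deg H) S
      fT = setSum f T
      gS = setSum g S
      dT = setSum (degMinus G S) T
      eH = eBetween H S T
      ΣA = ℚΣ.sum₂ A; ΣB = ℚΣ.sum₂ B; ΣC = ℚΣ.sum₂ C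
      ΣD = ℚΣ.sum₂ D; ΣE = ℚΣ.sum₂ E; ΣF = ℚΣ.sum₂ F′

  necessity : ∀ {n} (G H : Graph n) (g f : Fin n → ℕ) → (∀ x → g x ℕ.≤ f x) → H ⊆G G →
              AllFractionalFactorsIncluding G H g f → ∀ S T → Disjoint S T → Condition G H g f S T
  necessity G H g f g≤f H⊆G factors S T S∩T=∅ =
    condition-from-ℕ {G = G} {H} {g} {f} {S} {T}
      (factor⇒inequality G H H⊆G S T S∩T=∅ (factors (λ x → if T x then f x else g x) g≤r r≤f))
    where
    g≤r : ∀ x → g x ℕ.≤ (if T x then f x else g x)
    g≤r x with T x
    ... | true  = g≤f x
    ... | false = ℕP.≤-refl
    r≤f : ∀ x → (if T x then f x else g x) ℕ.≤ f x
    r≤f x with T x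
    ... | true  = ℕP.≤-refl
    ... | false = g≤f x

open FractionalFactors using (necessity; sufficiency)
open import Function.Bundles using (_⇔_; mk⇔)

theorem4 : ∀ {n} (G H : Graph n) (g f : Fin n → ℕ)
    → (∀ x → 1 ℕ.≤ g x) → (∀ x → g x ℕ.≤ f x) → H ⊆G G
    → AllFractionalFactorsIncluding G H g f
    ⇔ (∀ (S T : VSet n) → Disjoint S T → Condition G H g f S T)
theorem4 G H g f _ g≤f H⊆G = mk⇔ (necessity G H g f g≤f H⊆G) (sufficiency G H g f H⊆G)
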